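{- Let $\lambda\ge 0$, $\eta$ and $\alpha_1,\dots,\alpha_\lambda$ be integers with $0<\alpha_1<\cdots<\alpha_\lambda<\eta$ and $\alpha_i=\eta-\alpha_{\lambda+1-i}$, and let $k,r$ be integers with $k\ge r\ge\lambda\ge0$ and $0\le\lambda<k$. Let $\mu=(\mu_1,\ldots,\mu_\ell)\in\mathcal{B}_1(\alpha_1,\ldots,\alpha_\lambda;\eta,k,r)$ and let $\{\mu_{i+l}\}_{0\le l\le k-2}$ and $\{\mu_{j+l}\}_{0\le l\le k-2}$ be two $(k-1)$-sets of $\mu$. If $\mu_j>\mu_i$ and $\mu_{i+k-2}\ge\mu_j-2\eta$, with strict inequality if $\mu_j$ is overlined, then these two $(k-1)$-sets are of the same type.
   Context: Overpartitions: the first occurrence of a part size may be overlined. Parts are ordered $1<\bar1<2<\bar2<\cdots$; $\mu=(\mu_1,\dots,\mu_\ell)$ with $\mu_1\ge\cdots\ge\mu_\ell$ in this order; inequalities between parts are in this order, and $x\pm c\eta$ is the part of size $|x|\pm c\eta$ overlined iff $x$ is. $[x/\eta]=\lfloor|x|/\eta\rfloor$; $\overline{V}_\mu(N)$ is the number of overlined parts of $\mu$ that are $\le N$. $\mathcal{B}_1(\alpha_1,\ldots,\alpha_\lambda;\eta,k,r)$ is the set of overpartitions $\mu=(\mu_1,\dots,\mu_\ell)$ such that: every part has size $\equiv 0,\alpha_1,\ldots,\alpha_\lambda\pmod\eta$; a part is overlined if and only if its size is not a multiple of $\eta$; $\mu_i\ge\mu_{i+k-1}+\eta$ whenever $i+k-1\le\ell$,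 with strict inequality if $\mu_i$ is non-overlined; at most $r-1$ parts satisfy $\mu_i\le\eta$. A $(k-1)$-set of $\mu$ is a block of consecutive parts $\mu_i\ge\mu_{i+1}\ge\cdots\ge\mu_{i+k-2}$ with $\mu_i\le\mu_{i+k-2}+\eta$, strict inequality if $\mu_i$ is overlined. It is of even type if $[\mu_i/\eta]+\cdots+[\mu_{i+k-2}/\eta]\equiv r-1+\overline{V}_\mu(\mu_i)\pmod 2$, and of odd type otherwise. -}

module Defs where

open import Data.Nat using (ℕ; zero; suc; _+_; _*_; _∸_; _≤_; _<_; NonZero)
open import Data.Nat.DivMod using (_/_; _%_)
open import Data.Bool using (Bool; true; false; if_then_else_)
open import Data.List using (List; []; _∷_; length; map; upTo)
open import Data.Nat.ListAction using (sum)
open import Data.Product using (_×_)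
open import Data.Sum using (_⊎_)
open import Relation.Binary.PropositionalEquality using (_≡_; _≢_)
open import Relation.Nullary using (Dec; ¬_)

record Part : Set where
  constructor part
  field
    size : ℕ
    over : Bool
open Part public

-- The order 1 < 1̄ < 2 < 2̄ < ... is encoded by the key 2·|x| + [x overlined].
key : Part → ℕ
key x = 2 * size x + (if over x then 1 else 0)

_≺_ : Part → Part → Set
x ≺ y = key x < key y

_≼_ : Part → Part → Set
x ≼ y = key x ≤ key y

_⊕_ : Part → ℕ → Part
x ⊕ m = part (size x + m) (over x)

_⊖_ : Part → ℕ → Part
x ⊖ m = part (size x ∸ m) (over x)

plain : ℕ → Part
plain n = part n false

≼-strictIf : Bool → Part → Part → Set
≼-strictIf true  x y = x ≺ y
≼-strictIf false x y = x ≼ y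

dummy : Part
dummy = part 0 false

-- μ ! i = μ_i  (1-based; junk value outside 1 ≤ i ≤ ℓ, never used there)
_!_ : List Part → ℕ → Part
[]      ! _             = dummy
(x ∷ _) ! 1             = x
(_ ∷ xs) ! suc (suc i)  = xs ! suc i
(_ ∷ _) ! 0             = dummy

-- an overpartition: positive parts, nonincreasing in the order, and an
-- overlined part occurs at most once (only its first occurrence may be overlined)
IsOverpartition : List Part → Set
IsOverpartition μ =
  (∀ i → 1 ≤ i → i ≤ length μ → 1 ≤ size (μ ! i)) ×
  (∀ i → 1 ≤ i → i < length μ →
     (μ ! suc i) ≼ (μ ! i) × (over (μ ! suc i) ≡ true → (μ ! suc i) ≺ (μ ! i)))

count : {A : Set} → (A → Bool) → List A → ℕ
count p []       = 0
count p (x ∷ xs) = (if p x then 1 else 0) + count p xs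

_≤ᵇ'_ : ℕ → ℕ → Bool
zero  ≤ᵇ' _     = true
suc m ≤ᵇ' zero  = false
suc m ≤ᵇ' suc n = m ≤ᵇ' n

Vbar : List Part → Part → ℕ
Vbar μ N = count (λ x → if over x then key x ≤ᵇ' key N else false) μ

-- The set B₁(α₁,…,α_λ; η, k, r).  α is given 1-based: α 1, …, α λ.

module _ (λ' : ℕ) (α : ℕ → ℕ) (η : ℕ) .{{_ : NonZero η}} (k r : ℕ) where

  InB1 : List Part → Set
  InB1 μ =
    IsOverpartition μ ×
    (∀ i → 1 ≤ i → i ≤ length μ →
       (size (μ ! i) % η ≡ 0) ⊎
       (Data.Product.Σ ℕ (λ t → 1 ≤ t × t ≤ λ' × size (μ ! i) % η ≡ α t))) ×
    (∀ i → 1 ≤ i → i ≤ length μ →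
       (over (μ ! i) ≡ true → size (μ ! i) % η ≢ 0) ×
       (size (μ ! i) % η ≢ 0 → over (μ ! i) ≡ true)) ×
    (∀ i → 1 ≤ i → i + k ∸ 1 ≤ length μ →
       ≼-strictIf (Data.Bool.not (over (μ ! i))) ((μ ! (i + k ∸ 1)) ⊕ η) (μ ! i)) ×
    (count (λ x → key x ≤ᵇ' key (plain η)) μ < r)

  IsKSet : List Part → ℕ → Set
  IsKSet μ i =
    1 ≤ i × i ≤ length μ × i + k ∸ 2 ≤ length μ ×
    (∀ l → i ≤ l → l < i + k ∸ 2 → (μ ! suc l) ≼ (μ ! l)) ×
    ≼-strictIf (over (μ ! i)) (μ ! i) ((μ ! (i + k ∸ 2)) ⊕ η)

  floorSum : List Part → ℕ → ℕ
  floorSum μ i = sum (map (λ l → size (μ ! (i + l)) / η) (upTo (k ∸ 1)))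

  -- even type: floorSum ≡ r − 1 + V̄_μ(μ_i) (mod 2); with r ≥ 1 this is
  -- written (floorSum + 1) ≡ r + V̄_μ(μ_i) (mod 2)
  EvenType : List Part → ℕ → Set
  EvenType μ i = (floorSum μ i + 1) % 2 ≡ (r + Vbar μ (μ ! i)) % 2

  OddType : List Part → ℕ → Set
  OddType μ i = ¬ EvenType μ i

  SameType : List Part → ℕ → ℕ → Set
  SameType μ i j = (EvenType μ i × EvenType μ j) ⊎ (OddType μ i × OddType μ j)

module Submission where

-- For j ≤ t < i the gap condition μ_t ≥ μ_{t+k-1} + η and the bound μ_t ≤ μ_j ≤ μ_{i+k-2} + 2η
-- force [μ_{t+k-1}/η] = [μ_t/η] − 2 when μ_t is non-overlined and [μ_t/η] − 1 when it is
-- overlined (the latter by a count of residues mod η that uses λ < k).  So moving the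
-- (k-1)-set from t to t+1 lowers Σ[μ/η] by 2 − [μ_t overlined], while
-- V̄_μ(μ_t) − V̄_μ(μ_{t+1}) = [μ_t overlined]; hence Σ[μ/η] + V̄_μ(first part) drops by
-- exactly 2 per step, and its parity, which decides the type, is the same at j and at i.

open import Defs
open import Data.Nat using (ℕ; zero; suc; _+_; _*_; _∸_; _≤_; _<_; NonZero; >-nonZero⁻¹; z≤n; s≤s; _≟_; _≤?_)
open import Data.Nat.Properties
open import Data.Nat.DivMod
open import Data.Nat.Divisibility using (_∣_; _∣0; ∣-refl; n∣m*n)
open import Data.Nat.ListAction using (sum)
open import Data.Nat.ListAction.Properties using (sum-++)
open import Data.Nat.Tactic.RingSolver using (solve-∀)
open import Data.Bool using (Bool; true; false; if_then_else_; not; _∧_)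
open import Data.Bool.Properties using (∧-zeroʳ)
open import Data.Empty using (⊥; ⊥-elim)
open import Data.Fin using (Fin; toℕ; fromℕ<)
open import Data.Fin.Properties using (toℕ<n; toℕ-fromℕ<; toℕ-injective; injective⇒≤)
open import Data.List using (List; []; _∷_; _++_; [_]; length; map; upTo)
open import Data.List.Properties using (map-++; map-cong; map-applyUpTo; map-upTo; upTo-∷ʳ)
open import Data.Product using (Σ; _×_; _,_; proj₁; proj₂)
open import Data.Sum using (_⊎_; inj₁; inj₂)
open import Function using (_∘_)
open import Function.Bundles using (_⇔_; mk⇔; Equivalence)
open import Relation.Binary.Definitions using (tri<; tri≈; tri>)
open import Relation.Binary.PropositionalEquality hiding ([_])
open import Relation.Nullary using (Dec; yes; no; ¬_; contradiction)

module _ {η : ℕ} .{{_ : NonZero η}} where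

  /-unique : ∀ {m q} → q * η ≤ m → m < suc q * η → m / η ≡ q
  /-unique {m} {q} lo hi =
    ≤-antisym (≤-pred (m<n*o⇒m/o<n hi)) (subst (_≤ m / η) (m*n/n≡m q η) (/-monoˡ-≤ η lo))

  between-multiples⇒%≢0 : ∀ {m q} → q * η < m → m < suc q * η → m % η ≢ 0
  between-multiples⇒%≢0 {m} {q} lo hi m%η≡0 = <-irrefl (sym m≡qη) lo
    where
    m≡qη : m ≡ q * η
    m≡qη = trans (m≡m%n+[m/n]*n m η) (cong₂ (λ a b → a + b * η) m%η≡0 (/-unique {m} {q} (<⇒≤ lo) hi))

  %-injective-window : ∀ {c d} → c < d → d < c + η → c % η ≢ d % η
  %-injective-window {c} {d} c<d d<c+η eq with m≤n⇒m<n∨m≡n (/-monoˡ-≤ η (<⇒≤ c<d))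
  ... | inj₂ c/η≡d/η = <-irrefl c≡d c<d
    where
    c≡d : c ≡ d
    c≡d = trans (m≡m%n+[m/n]*n c η)
            (trans (cong₂ (λ a b → a + b * η) eq c/η≡d/η) (sym (m≡m%n+[m/n]*n d η)))
  ... | inj₁ c/η<d/η = <⇒≱ d<c+η (begin
      c + η                         ≡⟨ cong (_+ η) (m≡m%n+[m/n]*n c η) ⟩
      c % η + c / η * η + η         ≡⟨ +-assoc (c % η) _ η ⟩
      c % η + (c / η * η + η)       ≡⟨ cong₂ _+_ eq (+-comm _ η) ⟩
      d % η + suc (c / η) * η       ≤⟨ +-monoʳ-≤ (d % η) (*-monoˡ-≤ η c/η<d/η) ⟩
      d % η + d / η * η             ≡⟨ sym (m≡m%n+[m/n]*n d η) ⟩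
      d                             ∎)
    where open ≤-Reasoning

  <-suc-/-* : ∀ m → m < suc (m / η) * η
  <-suc-/-* m = begin-strict
    m                      ≡⟨ m≡m%n+[m/n]*n m η ⟩
    m % η + m / η * η      <⟨ +-monoˡ-< (m / η * η) (m%n<n m η) ⟩
    η + m / η * η          ∎
    where open ≤-Reasoning

  %≢0⇒/-*< : ∀ m → m % η ≢ 0 → m / η * η < m
  %≢0⇒/-*< m m%η≢0 = begin-strict
    m / η * η              <⟨ +-monoˡ-< (m / η * η) (n≢0⇒n>0 m%η≢0) ⟩
    m % η + m / η * η      ≡⟨ sym (m≡m%n+[m/n]*n m η) ⟩
    m                      ∎
    where open ≤-Reasoning

  /-below-gap : ∀ {x y a} → x / η ≡ suc a → a * η ≤ y → y + η ≤ x → y / η ≡ a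
  /-below-gap {x} {y} {a} x/η≡1+a a*η≤y y+η≤x = /-unique a*η≤y (+-cancelʳ-< η y (suc a * η) (begin-strict
    y + η                  ≤⟨ y+η≤x ⟩
    x                      <⟨ <-suc-/-* x ⟩
    suc (x / η) * η        ≡⟨ cong (λ q → suc q * η) x/η≡1+a ⟩
    η + suc a * η          ≡⟨ +-comm η _ ⟩
    suc a * η + η          ∎))
    where open ≤-Reasoning

  /-+-multiple : ∀ y k → (y + k * η) / η ≡ y / η + k
  /-+-multiple y k = trans (+-distrib-/-∣ʳ y (n∣m*n k)) (cong (y / η +_) (m*n/n≡m k η))

  multiple⇒/-mono-< : ∀ {z x} → x % η ≡ 0 → z < x → z / η < x / η
  multiple⇒/-mono-< {z} {x} x%η≡0 z<x = *-cancelʳ-< η (z / η) (x / η) (begin-strict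
    z / η * η              ≤⟨ m/n*n≤m z η ⟩
    z                      <⟨ z<x ⟩
    x                      ≡⟨ m≡m%n+[m/n]*n x η ⟩
    x % η + x / η * η      ≡⟨ cong (_+ x / η * η) x%η≡0 ⟩
    x / η * η              ∎)
    where open ≤-Reasoning

  /-two-below-multiple : ∀ {x y} → x % η ≡ 0 → y + η < x → x ≤ y + 2 * η → x / η ≡ y / η + 2
  /-two-below-multiple {x} {y} x%η≡0 y+η<x x≤y+2η = ≤-antisym
    (≤-trans (/-monoˡ-≤ η x≤y+2η) (≤-reflexive (/-+-multiple y 2)))
    (subst (_≤ x / η) (sym (+-suc (y / η) 1)) (begin-strict
      y / η + 1            ≡⟨ sym (/-+-multiple y 1) ⟩
      (y + 1 * η) / η      ≡⟨ cong (λ e → (y + e) / η) (*-identityˡ η) ⟩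
      (y + η) / η          <⟨ multiple⇒/-mono-< x%η≡0 y+η<x ⟩
      x / η                ∎))
    where open ≤-Reasoning

  /-one-below-gap : ∀ {x y} → y + η ≤ x → (x / η ∸ 1) * η ≤ y → x / η + 1 ≡ y / η + 2
  /-one-below-gap {x} {y} y+η≤x lower with x / η in x/η≡q
  ... | zero  = contradiction (m/n≡0⇒m<n x/η≡q) (≤⇒≯ (≤-trans (m≤n+m η y) y+η≤x))
  ... | suc a = trans (sym (+-suc a 1)) (cong (_+ 2) (sym (/-below-gap x/η≡q lower y+η≤x)))

∸≤⇒≤+ : ∀ m n {o} → m ∸ n ≤ o → m ≤ o + n
∸≤⇒≤+ m n {o} h = ≤-trans (m≤n+m∸n m n) (≤-trans (+-monoʳ-≤ n h) (≤-reflexive (+-comm n o)))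

∸<⇒<+ : ∀ m n {o} → m ∸ n < o → m < o + n
∸<⇒<+ m n {o} h = ≤-<-trans (m≤n+m∸n m n) (<-≤-trans (+-monoʳ-< n h) (≤-reflexive (+-comm n o)))

+-congʳ-%2 : ∀ x y z → x % 2 ≡ y % 2 → (x + z) % 2 ≡ (y + z) % 2
+-congʳ-%2 x y z eq =
  trans (%-distribˡ-+ x z 2) (trans (cong (λ a → (a + z % 2) % 2) eq) (sym (%-distribˡ-+ y z 2)))

+-double-%2 : ∀ w z → (w + z + z) % 2 ≡ w % 2
+-double-%2 w z = trans (cong (_% 2) (double w z)) ([m+kn]%n≡m%n w z 2)
  where
  double : ∀ w z → w + z + z ≡ w + z * 2
  double = solve-∀

+-cancelʳ-%2 : ∀ x y z → (x + z) % 2 ≡ (y + z) % 2 → x % 2 ≡ y % 2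
+-cancelʳ-%2 x y z eq = begin
  x % 2                ≡⟨ sym (+-double-%2 x z) ⟩
  (x + z + z) % 2      ≡⟨ +-congʳ-%2 (x + z) (y + z) z eq ⟩
  (y + z + z) % 2      ≡⟨ +-double-%2 y z ⟩
  y % 2                ∎
  where open ≡-Reasoning

%2-move-+ : ∀ a b r → ((a + 1) % 2 ≡ (r + b) % 2) ⇔ ((a + b + 1) % 2 ≡ r % 2)
%2-move-+ a b r = mk⇔
  (λ h → trans (cong (_% 2) (swap a b)) (trans (+-congʳ-%2 (a + 1) (r + b) b h) (+-double-%2 r b)))
  (λ h → +-cancelʳ-%2 (a + 1) (r + b) b (trans (cong (_% 2) (sym (swap a b))) (trans h (sym (+-double-%2 r b)))))
  where
  swap : ∀ a b → a + b + 1 ≡ a + 1 + b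
  swap = solve-∀

same-truth-value : ∀ {A B C : Set} → Dec C → A ⇔ C → B ⇔ C → (A × B) ⊎ (¬ A × ¬ B)
same-truth-value (yes c) A⇔C B⇔C = inj₁ (Equivalence.from A⇔C c , Equivalence.from B⇔C c)
same-truth-value (no ¬c) A⇔C B⇔C = inj₂ (¬c ∘ Equivalence.to A⇔C , ¬c ∘ Equivalence.to B⇔C)

telescope : ∀ (Q : ℕ → ℕ) c j h → (∀ l → l < h → Q (j + l) ≡ Q (suc (j + l)) + c) →
            Q j ≡ Q (j + h) + h * c
telescope Q c j zero    _    = sym (trans (+-identityʳ _) (cong Q (+-identityʳ j)))
telescope Q c j (suc h) step = begin
  Q j                          ≡⟨ telescope Q c j h (λ l l<h → step l (m<n⇒m<1+n l<h)) ⟩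
  Q (j + h) + h * c            ≡⟨ cong (_+ h * c) (step h ≤-refl) ⟩
  Q (suc (j + h)) + c + h * c  ≡⟨ +-assoc (Q (suc (j + h))) c (h * c) ⟩
  Q (suc (j + h)) + suc h * c  ≡⟨ cong (λ x → Q x + suc h * c) (sym (+-suc j h)) ⟩
  Q (j + suc h) + suc h * c    ∎
  where open ≡-Reasoning

window-invariant-step : ∀ {S S' V V' F F' b} → S + F' ≡ F + S' → F + b ≡ F' + 2 → V ≡ V' + b →
                        S + V ≡ S' + V' + 2
window-invariant-step {S} {S'} {V} {V'} {F} {F'} {b} slide step drop = +-cancelʳ-≡ F' _ _ (begin
  S + V + F'           ≡⟨ regroup₁ S V F' ⟩
  (S + F') + V         ≡⟨ cong₂ _+_ slide drop ⟩
  (F + S') + (V' + b)  ≡⟨ regroup₂ F S' V' b ⟩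
  (F + b) + (S' + V')  ≡⟨ cong (_+ (S' + V')) step ⟩
  (F' + 2) + (S' + V') ≡⟨ regroup₃ F' S' V' ⟩
  S' + V' + 2 + F'     ∎)
  where
  open ≡-Reasoning
  regroup₁ : ∀ S V F' → S + V + F' ≡ (S + F') + V
  regroup₁ = solve-∀
  regroup₂ : ∀ F S' V' b → (F + S') + (V' + b) ≡ (F + b) + (S' + V')
  regroup₂ = solve-∀
  regroup₃ : ∀ F' S' V' → (F' + 2) + (S' + V') ≡ S' + V' + 2 + F'
  regroup₃ = solve-∀

sum-map-upTo-sucʳ : ∀ (g : ℕ → ℕ) n → sum (map g (upTo (suc n))) ≡ sum (map g (upTo n)) + g n
sum-map-upTo-sucʳ g n = begin
  sum (map g (upTo (suc n)))             ≡⟨ cong (sum ∘ map g) (sym (upTo-∷ʳ n)) ⟩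
  sum (map g (upTo n ++ [ n ]))          ≡⟨ cong sum (map-++ g (upTo n) [ n ]) ⟩
  sum (map g (upTo n) ++ [ g n ])        ≡⟨ sum-++ (map g (upTo n)) [ g n ] ⟩
  sum (map g (upTo n)) + (g n + 0)       ≡⟨ cong (sum (map g (upTo n)) +_) (+-identityʳ (g n)) ⟩
  sum (map g (upTo n)) + g n             ∎
  where open ≡-Reasoning

sum-map-upTo-sucˡ : ∀ (g : ℕ → ℕ) n → sum (map g (upTo (suc n))) ≡ g 0 + sum (map (g ∘ suc) (upTo n))
sum-map-upTo-sucˡ g n =
  cong (λ xs → g 0 + sum xs) (trans (map-applyUpTo suc g n) (sym (map-upTo (g ∘ suc) n)))

sum-window-slide : ∀ (f : ℕ → ℕ) s m →
  sum (map (λ l → f (s + l)) (upTo m)) + f (s + m) ≡ f s + sum (map (λ l → f (suc s + l)) (upTo m))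
sum-window-slide f s m = begin
  sum (map (λ l → f (s + l)) (upTo m)) + f (s + m)      ≡⟨ sym (sum-map-upTo-sucʳ (λ l → f (s + l)) m) ⟩
  sum (map (λ l → f (s + l)) (upTo (suc m)))            ≡⟨ sum-map-upTo-sucˡ (λ l → f (s + l)) m ⟩
  f (s + 0) + sum (map (λ l → f (s + suc l)) (upTo m))  ≡⟨ cong₂ _+_ (cong f (+-identityʳ s))
                                                              (cong sum (map-cong (cong f ∘ +-suc s) (upTo m))) ⟩
  f s + sum (map (λ l → f (suc s + l)) (upTo m))        ∎
  where open ≡-Reasoning

bit : Bool → ℕ
bit b = if b then 1 else 0

bit≤1 : ∀ b → bit b ≤ 1
bit≤1 true  = ≤-refl
bit≤1 false = z≤n

double-cancel-< : ∀ a b c d → d ≤ c → 2 * a + c < 2 * b + d → a < b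
double-cancel-< a b c d d≤c lt =
  *-cancelˡ-< 2 a b (+-cancelʳ-< d (2 * a) (2 * b) (≤-<-trans (+-monoʳ-≤ (2 * a) d≤c) lt))

double-cancel-≤ : ∀ a b c d → d ≤ 1 → 2 * a + c ≤ 2 * b + d → a ≤ b
double-cancel-≤ a b c d d≤1 le = ≤-pred (double-cancel-< a (suc b) c 0 z≤n (begin-strict
  2 * a + c          ≤⟨ le ⟩
  2 * b + d          ≤⟨ +-monoʳ-≤ (2 * b) d≤1 ⟩
  2 * b + 1          <⟨ ≤-reflexive (cong suc (+-comm (2 * b) 1)) ⟩
  suc (suc (2 * b))  ≡⟨ sym (trans (+-identityʳ _) (*-suc 2 b)) ⟩
  2 * suc b + 0      ∎))
  where open ≤-Reasoning

≼⇒size≤ : ∀ {x y} → x ≼ y → size x ≤ size y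
≼⇒size≤ {part a b} {part c d} = double-cancel-≤ a c (bit b) (bit d) (bit≤1 d)

≺-over⇒size< : ∀ {x y} → over x ≡ true → x ≺ y → size x < size y
≺-over⇒size< {part a true} {part c d} refl = double-cancel-< a c 1 (bit d) (bit≤1 d)

≺-plain⇒size< : ∀ {x y} → over y ≡ false → x ≺ y → size x < size y
≺-plain⇒size< {part a b} {part c false} refl = double-cancel-< a c (bit b) 0 z≤n

≼-plain-over⇒≺ : ∀ {x y} → over x ≡ false → over y ≡ true → x ≼ y → x ≺ y
≼-plain-over⇒≺ {part a false} {part c true} refl refl x≼y = begin-strict
  2 * a + 0   ≡⟨ +-identityʳ (2 * a) ⟩
  2 * a       ≤⟨ *-monoʳ-≤ 2 (≼⇒size≤ {part a false} {part c true} x≼y) ⟩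
  2 * c       <⟨ ≤-reflexive (+-comm 1 (2 * c)) ⟩
  2 * c + 1   ∎
  where open ≤-Reasoning

≼-strictIf⇒≼ : ∀ b {x y} → ≼-strictIf b x y → x ≼ y
≼-strictIf⇒≼ true  = <⇒≤
≼-strictIf⇒≼ false x≼y = x≼y

≼-strictIf⇒size≤ : ∀ {x y} → ≼-strictIf (over x) x y → size x ≤ size y
≼-strictIf⇒size≤ {x} {y} = ≼⇒size≤ {x} {y} ∘ ≼-strictIf⇒≼ (over x)

≼-strictIf-over⇒size< : ∀ {x y} → over x ≡ true → ≼-strictIf (over x) x y → size x < size y
≼-strictIf-over⇒size< {part a true} refl = ≺-over⇒size< {part a true} refl

-- Counting overlined parts

≤⇒≤ᵇ' : ∀ {m n} → m ≤ n → (m ≤ᵇ' n) ≡ true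
≤⇒≤ᵇ' z≤n       = refl
≤⇒≤ᵇ' (s≤s m≤n) = ≤⇒≤ᵇ' m≤n

≤ᵇ'⇒≤ : ∀ m n → (m ≤ᵇ' n) ≡ true → m ≤ n
≤ᵇ'⇒≤ zero    n       _ = z≤n
≤ᵇ'⇒≤ (suc m) (suc n) h = s≤s (≤ᵇ'⇒≤ m n h)

>⇒≤ᵇ'-false : ∀ {m n} → n < m → (m ≤ᵇ' n) ≡ false
>⇒≤ᵇ'-false {suc m} {zero}  _         = refl
>⇒≤ᵇ'-false {suc m} {suc n} (s≤s n<m) = >⇒≤ᵇ'-false n<m

count-+ : ∀ {A : Set} (p q r : A → Bool) → (∀ x → bit (p x) ≡ bit (q x) + bit (r x)) →
          ∀ xs → count p xs ≡ count q xs + count r xs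
count-+ p q r split []       = refl
count-+ p q r split (x ∷ xs) = begin
  bit (p x) + count p xs                          ≡⟨ cong₂ _+_ (split x) (count-+ p q r split xs) ⟩
  bit (q x) + bit (r x) + (count q xs + count r xs) ≡⟨ +-+-comm (bit (q x)) (bit (r x)) _ _ ⟩
  bit (q x) + count q xs + (bit (r x) + count r xs) ∎
  where
  open ≡-Reasoning
  +-+-comm : ∀ a b c d → a + b + (c + d) ≡ a + c + (b + d)
  +-+-comm = solve-∀

count-none : ∀ (p : Part → Bool) xs →
             (∀ s → 1 ≤ s → s ≤ length xs → p (xs ! s) ≡ false) → count p xs ≡ 0
count-none p []       _    = refl
count-none p (x ∷ xs) none rewrite none 1 ≤-refl (s≤s z≤n) =
  count-none p xs λ { (suc s) _ s≤len → none (suc (suc s)) (s≤s z≤n) (s≤s s≤len) }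

count-single : ∀ (p : Part → Bool) xs t → 1 ≤ t → t ≤ length xs →
               (∀ s → 1 ≤ s → s ≤ length xs → s ≢ t → p (xs ! s) ≡ false) →
               count p xs ≡ bit (p (xs ! t))
count-single p (x ∷ xs) (suc zero) _ _ only = trans
  (cong (bit (p x) +_) (count-none p xs λ { (suc s) _ s≤len →
     only (suc (suc s)) (s≤s z≤n) (s≤s s≤len) (λ ()) }))
  (+-identityʳ (bit (p x)))
count-single p (x ∷ xs) (suc (suc t)) _ (s≤s t<len) only rewrite only 1 ≤-refl (s≤s z≤n) (λ ()) =
  count-single p xs (suc t) (s≤s z≤n) t<len λ { (suc s) _ s≤len s≢t →
    only (suc (suc s)) (s≤s z≤n) (s≤s s≤len) (s≢t ∘ suc-injective) }

atMost : Part → Part → Bool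
atMost N x = if over x then key x ≤ᵇ' key N else false

atMost-mono : ∀ {M N} x → M ≼ N → atMost M x ≡ true → atMost N x ≡ true
atMost-mono {M} {N} (part a true) M≼N h =
  ≤⇒≤ᵇ' (≤-trans (≤ᵇ'⇒≤ (key (part a true)) (key M) h) M≼N)

between : Part → Part → Part → Bool
between M N x = not (atMost M x) ∧ atMost N x

atMost-split : ∀ {M N} → M ≼ N → ∀ x → bit (atMost N x) ≡ bit (atMost M x) + bit (between M N x)
atMost-split {M} {N} M≼N x with atMost M x in eq
... | true  = cong bit (atMost-mono {M} {N} x M≼N eq)
... | false = refl

between-below : ∀ {M N x} → (over x ≡ true → x ≼ M) → between M N x ≡ false
between-below {x = part a true}  x≼M rewrite ≤⇒≤ᵇ' (x≼M refl) = refl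
between-below {x = part a false} _   = refl

between-above : ∀ {M N x} → (over x ≡ true → N ≺ x) → between M N x ≡ false
between-above {x = part a true}  N≺x rewrite >⇒≤ᵇ'-false (N≺x refl) = ∧-zeroʳ _
between-above {x = part a false} _   = refl

between-self : ∀ {M x} → (over x ≡ true → M ≺ x) → bit (between M x x) ≡ bit (over x)
between-self {x = part a true}  M≺x rewrite >⇒≤ᵇ'-false (M≺x refl) | ≤⇒≤ᵇ' (≤-refl {2 * a + 1}) = refl
between-self {x = part a false} _   = refl

module Overpartition (μ : List Part) (isOP : IsOverpartition μ) where

  !-suc-≼ : ∀ {s} → 1 ≤ s → suc s ≤ length μ → (μ ! suc s) ≼ (μ ! s)
  !-suc-≼ {s} 1≤s s<len = proj₁ (proj₂ isOP s 1≤s s<len)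

  over-suc⇒!-suc-≺ : ∀ {s} → 1 ≤ s → suc s ≤ length μ → over (μ ! suc s) ≡ true → (μ ! suc s) ≺ (μ ! s)
  over-suc⇒!-suc-≺ {s} 1≤s s<len = proj₂ (proj₂ isOP s 1≤s s<len)

  over⇒!-suc-≺ : ∀ {s} → 1 ≤ s → suc s ≤ length μ → over (μ ! s) ≡ true → (μ ! suc s) ≺ (μ ! s)
  over⇒!-suc-≺ {s} 1≤s s<len over-s = by-cases (over (μ ! suc s)) refl
    where
    by-cases : ∀ b → over (μ ! suc s) ≡ b → (μ ! suc s) ≺ (μ ! s)
    by-cases true  over-suc = over-suc⇒!-suc-≺ 1≤s s<len over-suc
    by-cases false over-suc = ≼-plain-over⇒≺ {μ ! suc s} {μ ! s} over-suc over-s (!-suc-≼ 1≤s s<len)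

  !-antitone : ∀ {s s'} → 1 ≤ s → s ≤ s' → s' ≤ length μ → (μ ! s') ≼ (μ ! s)
  !-antitone {s} {s'} 1≤s s≤s' s'≤len with m≤n⇒m<n∨m≡n s≤s'
  ... | inj₂ refl = ≤-refl
  ... | inj₁ (s≤s {n = s''} s≤s'') =
    ≤-trans (!-suc-≼ (≤-trans 1≤s s≤s'') s'≤len) (!-antitone 1≤s s≤s'' (≤-trans (n≤1+n s'') s'≤len))

  over⇒!-≺ : ∀ {s s'} → 1 ≤ s → s < s' → s' ≤ length μ → over (μ ! s) ≡ true → (μ ! s') ≺ (μ ! s)
  over⇒!-≺ {s} {s'} 1≤s s<s' s'≤len over-s =
    ≤-<-trans (!-antitone (s≤s z≤n) s<s' s'≤len) (over⇒!-suc-≺ 1≤s (≤-trans s<s' s'≤len) over-s)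

  Vbar-suc : ∀ {t} → 1 ≤ t → suc t ≤ length μ →
             Vbar μ (μ ! t) ≡ Vbar μ (μ ! suc t) + bit (over (μ ! t))
  Vbar-suc {t} 1≤t t<len = begin
    count (atMost (μ ! t)) μ
      ≡⟨ count-+ _ _ _ (atMost-split {μ ! suc t} {μ ! t} (!-suc-≼ 1≤t t<len)) μ ⟩
    count (atMost (μ ! suc t)) μ + count (between (μ ! suc t) (μ ! t)) μ
      ≡⟨ cong (Vbar μ (μ ! suc t) +_) counted-once ⟩
    Vbar μ (μ ! suc t) + bit (over (μ ! t))
      ∎
    where
    open ≡-Reasoning
    t≤len : t ≤ length μ
    t≤len = ≤-trans (n≤1+n t) t<len

    between-elsewhere : ∀ s → 1 ≤ s → s ≤ length μ → s ≢ t → between (μ ! suc t) (μ ! t) (μ ! s) ≡ false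
    between-elsewhere s 1≤s s≤len s≢t with <-cmp s t
    ... | tri< s<t _ _ = between-above {μ ! suc t} {μ ! t} {μ ! s} (over⇒!-≺ 1≤s s<t t≤len)
    ... | tri≈ _ s≡t _ = ⊥-elim (s≢t s≡t)
    ... | tri> _ _ t<s = between-below {μ ! suc t} {μ ! t} {μ ! s} (λ _ → !-antitone (s≤s z≤n) t<s s≤len)

    counted-once : count (between (μ ! suc t) (μ ! t)) μ ≡ bit (over (μ ! t))
    counted-once = trans (count-single _ μ t 1≤t t≤len between-elsewhere)
                         (between-self {μ ! suc t} {μ ! t} (over⇒!-suc-≺ 1≤t t<len))

-- Descending chains with distinct residues

Descending : (ℕ → ℕ) → ℕ → Set
Descending v m = ∀ p → p < m → v (suc p) < v p

descending⇒< : ∀ {v m p q} → Descending v m → p < q → q ≤ m → v q < v p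
descending⇒< {v} {m} {p} {suc q} desc (s≤s p≤q) q<m with m≤n⇒m<n∨m≡n p≤q
... | inj₂ refl = desc q q<m
... | inj₁ p<q  = <-trans (desc q q<m) (descending⇒< desc p<q (≤-trans (n≤1+n q) q<m))

glue : ℕ → (ℕ → ℕ) → (ℕ → ℕ) → ℕ → ℕ
glue a       u v zero    = u 0
glue zero    u v (suc p) = v p
glue (suc a) u v (suc p) = glue a (u ∘ suc) v p

glue-descending : ∀ {a b u v} → Descending u a → Descending v b → v 0 < u a →
                  Descending (glue a u v) (suc (a + b))
glue-descending {zero}  du dv v0<ua zero    _             = v0<ua
glue-descending {zero}  du dv v0<ua (suc p) (s≤s p<b)     = dv p p<b
glue-descending {suc a} du dv v0<ua zero    _             = du 0 (s≤s z≤n)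
glue-descending {suc a} du dv v0<ua (suc p) (s≤s p<a+b) =
  glue-descending (λ p p<a → du (suc p) (s≤s p<a)) dv v0<ua p p<a+b

glue-all : ∀ (P : ℕ → Set) {a b u v} → (∀ p → p ≤ a → P (u p)) → (∀ p → p ≤ b → P (v p)) →
           ∀ p → p ≤ suc (a + b) → P (glue a u v p)
glue-all P         Pu Pv zero    _             = Pu 0 z≤n
glue-all P {zero}  Pu Pv (suc p) (s≤s p≤b)     = Pv p p≤b
glue-all P {suc a} Pu Pv (suc p) (s≤s p≤1+a+b) = glue-all P (λ p p≤a → Pu (suc p) (s≤s p≤a)) Pv p p≤1+a+b

module Residues (lam : ℕ) (α : ℕ → ℕ) (η : ℕ) .{{_ : NonZero η}} where

  AlphaResidue : ℕ → Set
  AlphaResidue x = Σ ℕ (λ τ → 1 ≤ τ × τ ≤ lam × x % η ≡ α τ)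

  record ResidueChain (w : ℕ) (v : ℕ → ℕ) (m : ℕ) : Set where
    field
      descending : Descending v m
      inWindow   : ∀ p → p ≤ m → v p ≤ w × w < v p + η
      residue    : ∀ p → p ≤ m → AlphaResidue (v p)

  glue-chain : ∀ {w u v a b} → ResidueChain w u a → ResidueChain w v b → v 0 < u a →
               ResidueChain w (glue a u v) (suc (a + b))
  glue-chain {w} cu cv v0<ua = record
    { descending = glue-descending (descending cu) (descending cv) v0<ua
    ; inWindow   = glue-all (λ x → x ≤ w × w < x + η) (inWindow cu) (inWindow cv)
    ; residue    = glue-all AlphaResidue (residue cu) (residue cv)
    }
    where open ResidueChain

  chain-length : ∀ {w v m} → ResidueChain w v m → m < lam
  chain-length {w} {v} {m} chain = injective⇒≤ {f = index} index-injective
    where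
    open ResidueChain chain

    index : Fin (suc m) → Fin lam
    index p with residue (toℕ p) (≤-pred (toℕ<n p))
    ... | suc τ' , _ , τ≤lam , _ = fromℕ< τ≤lam

    residue-of-index : ∀ p → v (toℕ p) % η ≡ α (suc (toℕ (index p)))
    residue-of-index p with residue (toℕ p) (≤-pred (toℕ<n p))
    ... | suc τ' , _ , τ≤lam , eq = trans eq (cong (α ∘ suc) (sym (toℕ-fromℕ< τ≤lam)))

    distinct : ∀ p q → toℕ p < toℕ q → v (toℕ p) % η ≢ v (toℕ q) % η
    distinct p q p<q = ≢-sym (%-injective-window vq<vp vp<vq+η)
      where
      q≤m : toℕ q ≤ m
      q≤m = ≤-pred (toℕ<n q)
      vq<vp : v (toℕ q) < v (toℕ p)
      vq<vp = descending⇒< descending p<q q≤m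
      vp<vq+η : v (toℕ p) < v (toℕ q) + η
      vp<vq+η = ≤-<-trans (proj₁ (inWindow (toℕ p) (≤-trans (<⇒≤ p<q) q≤m))) (proj₂ (inWindow (toℕ q) q≤m))

    index-injective : ∀ {p q} → index p ≡ index q → p ≡ q
    index-injective {p} {q} eq with <-cmp (toℕ p) (toℕ q)
    ... | tri< p<q _ _ = contradiction same-residue (distinct p q p<q)
      where
      same-residue : v (toℕ p) % η ≡ v (toℕ q) % η
      same-residue = trans (residue-of-index p) (trans (cong (α ∘ suc ∘ toℕ) eq) (sym (residue-of-index q)))
    ... | tri≈ _ p≡q _ = toℕ-injective p≡q
    ... | tri> _ _ q<p = contradiction (sym same-residue) (distinct q p q<p)
      where
      same-residue : v (toℕ p) % η ≡ v (toℕ q) % η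
      same-residue = trans (residue-of-index p) (trans (cong (α ∘ suc ∘ toℕ) eq) (sym (residue-of-index q)))

three-runs-length : ∀ {j t i n} → j ≤ t → t + suc n ≤ i + n → i ≤ j + n →
                    (t ∸ j) + suc ((i + n ∸ (t + suc n)) + (j + n ∸ i)) ≡ n
three-runs-length {j} {t} {i} {n} j≤t y≤i+n i≤j+n = +-cancelˡ-≡ (j + t + i + n) _ _ (begin
  j + t + i + n + (d + suc (e + f))   ≡⟨ regroup j t i n d e f ⟩
  (j + d) + (t + suc n + e) + (i + f)  ≡⟨ cong₂ _+_ (cong₂ _+_ (m+[n∸m]≡n j≤t) (m+[n∸m]≡n y≤i+n)) (m+[n∸m]≡n i≤j+n) ⟩
  t + (i + n) + (j + n)               ≡⟨ regroup′ j t i n ⟩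
  j + t + i + n + n                   ∎)
  where
  open ≡-Reasoning
  d e f : ℕ
  d = t ∸ j
  e = i + n ∸ (t + suc n)
  f = j + n ∸ i
  regroup : ∀ j t i n d e f → j + t + i + n + (d + suc (e + f)) ≡ (j + d) + (t + suc n + e) + (i + f)
  regroup = solve-∀
  regroup′ : ∀ j t i n → t + (i + n) + (j + n) ≡ j + t + i + n + n
  regroup′ = solve-∀

two-runs-length : ∀ {j t i n} → j ≤ t → t + suc n ≤ i + n → j + n < i →
                  n ≤ (t ∸ j) + (i + n ∸ (t + suc n))
two-runs-length {j} {t} {i} {n} j≤t y≤i+n j+n<i =
  ≤-pred (+-cancelˡ-< j n (suc (d + e)) (subst (j + n <_) (sym ends-at-i) j+n<i))
  where
  open ≡-Reasoning
  d e : ℕ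
  d = t ∸ j
  e = i + n ∸ (t + suc n)
  ends-at-i : j + suc (d + e) ≡ i
  ends-at-i = +-cancelˡ-≡ (t + n) _ _ (begin
    t + n + (j + suc (d + e))   ≡⟨ regroup j t n d e ⟩
    (j + d) + (t + suc n + e)  ≡⟨ cong₂ _+_ (m+[n∸m]≡n j≤t) (m+[n∸m]≡n y≤i+n) ⟩
    t + (i + n)                ≡⟨ regroup′ t i n ⟩
    t + n + i                  ∎)
    where
    regroup : ∀ j t n d e → t + n + (j + suc (d + e)) ≡ (j + d) + (t + suc n + e)
    regroup = solve-∀
    regroup′ : ∀ t i n → t + (i + n) ≡ t + n + i
    regroup′ = solve-∀

-- Here k = n + 2.
module Element (lam : ℕ) (α : ℕ → ℕ) (η : ℕ) .{{_ : NonZero η}} (n : ℕ) (μ : List Part)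
  (isOP : IsOverpartition μ)
  (residues : ∀ s → 1 ≤ s → s ≤ length μ →
     (size (μ ! s) % η ≡ 0) ⊎ Residues.AlphaResidue lam α η (size (μ ! s)))
  (overlined : ∀ s → 1 ≤ s → s ≤ length μ →
     (over (μ ! s) ≡ true → size (μ ! s) % η ≢ 0) × (size (μ ! s) % η ≢ 0 → over (μ ! s) ≡ true))
  (gap : ∀ s → 1 ≤ s → s + suc (suc n) ∸ 1 ≤ length μ →
     ≼-strictIf (not (over (μ ! s))) ((μ ! (s + suc (suc n) ∸ 1)) ⊕ η) (μ ! s))
  where

  open Residues lam α η
  open Overpartition μ isOP

  ‖_‖ : ℕ → ℕ
  ‖ s ‖ = size (μ ! s)

  over⇒%≢0 : ∀ {s} → 1 ≤ s → s ≤ length μ → over (μ ! s) ≡ true → ‖ s ‖ % η ≢ 0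
  over⇒%≢0 {s} 1≤s s≤len = proj₁ (overlined s 1≤s s≤len)

  %≢0⇒over : ∀ {s} → 1 ≤ s → s ≤ length μ → ‖ s ‖ % η ≢ 0 → over (μ ! s) ≡ true
  %≢0⇒over {s} 1≤s s≤len = proj₂ (overlined s 1≤s s≤len)

  plain⇒%≡0 : ∀ {s} → 1 ≤ s → s ≤ length μ → over (μ ! s) ≡ false → ‖ s ‖ % η ≡ 0
  plain⇒%≡0 {s} 1≤s s≤len plain with ‖ s ‖ % η ≟ 0
  ... | yes %≡0 = %≡0
  ... | no  %≢0 = contradiction (trans (sym (%≢0⇒over 1≤s s≤len %≢0)) plain) λ ()

  gap-≼ : ∀ {s} → 1 ≤ s → s + suc n ≤ length μ →
          ≼-strictIf (not (over (μ ! s))) ((μ ! (s + suc n)) ⊕ η) (μ ! s)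
  gap-≼ {s} 1≤s end≤len = subst (λ e → ≼-strictIf (not (over (μ ! s))) ((μ ! e) ⊕ η) (μ ! s)) last≡
    (gap s 1≤s (subst (_≤ length μ) (sym last≡) end≤len))
    where
    last≡ : s + suc (suc n) ∸ 1 ≡ s + suc n
    last≡ = +-∸-assoc s (s≤s z≤n)

  gap-size : ∀ {s} → 1 ≤ s → s + suc n ≤ length μ → ‖ s + suc n ‖ + η ≤ ‖ s ‖
  gap-size {s} 1≤s end≤len = ≼⇒size≤ {(μ ! (s + suc n)) ⊕ η} {μ ! s} (≼-strictIf⇒≼ _ (gap-≼ 1≤s end≤len))

  gap-size-plain : ∀ {s} → 1 ≤ s → s + suc n ≤ length μ → over (μ ! s) ≡ false → ‖ s + suc n ‖ + η < ‖ s ‖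
  gap-size-plain {s} 1≤s end≤len plain = ≺-plain⇒size< {(μ ! (s + suc n)) ⊕ η} {μ ! s} plain
    (subst (λ b → ≼-strictIf (not b) ((μ ! (s + suc n)) ⊕ η) (μ ! s)) plain (gap-≼ 1≤s end≤len))

  run : ℕ → ℕ → ℕ → ℕ
  run s e p = ‖ s + p ‖ + e

  run-start : ∀ s e → run s e 0 ≡ ‖ s ‖ + e
  run-start s e = cong (λ x → ‖ x ‖ + e) (+-identityʳ s)

  run-end : ∀ {s s'} e → s ≤ s' → run s e (s' ∸ s) ≡ ‖ s' ‖ + e
  run-end e s≤s' = cong (λ x → ‖ x ‖ + e) (m+[n∸m]≡n s≤s')

  run-chain : ∀ {s s'} q {e w} → η ∣ e → 1 ≤ s → s ≤ s' → s' ≤ length μ →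
              q * η < ‖ s' ‖ + e → ‖ s ‖ + e < suc q * η →
              ‖ s ‖ + e ≤ w → w < ‖ s' ‖ + e + η →
              ResidueChain w (run s e) (s' ∸ s)
  run-chain {s} {s'} q {e} {w} η∣e 1≤s s≤s' s'≤len low high start≤w w<end = record
    { descending = λ p p<m → +-monoˡ-< e (strict-step p<m)
    ; inWindow   = λ p p≤m → ≤-trans (run≤start p≤m) start≤w , <-≤-trans w<end (+-monoˡ-≤ η (end≤run p≤m))
    ; residue    = residue
    }
    where
    m : ℕ
    m = s' ∸ s

    position≤ : ∀ {p} → p ≤ m → s + p ≤ s'
    position≤ {p} p≤m = subst (s + p ≤_) (m+[n∸m]≡n s≤s') (+-monoʳ-≤ s p≤m)

    1≤position : ∀ p → 1 ≤ s + p
    1≤position p = ≤-trans 1≤s (m≤m+n s p)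

    position≤len : ∀ {p} → p ≤ m → s + p ≤ length μ
    position≤len p≤m = ≤-trans (position≤ p≤m) s'≤len

    run≤start : ∀ {p} → p ≤ m → run s e p ≤ ‖ s ‖ + e
    run≤start {p} p≤m = +-monoˡ-≤ e (≼⇒size≤ {μ ! (s + p)} {μ ! s} (!-antitone 1≤s (m≤m+n s p) (position≤len p≤m)))

    end≤run : ∀ {p} → p ≤ m → ‖ s' ‖ + e ≤ run s e p
    end≤run {p} p≤m = +-monoˡ-≤ e (≼⇒size≤ {μ ! s'} {μ ! (s + p)} (!-antitone (1≤position p) (position≤ p≤m) s'≤len))

    %≢0 : ∀ {p} → p ≤ m → ‖ s + p ‖ % η ≢ 0
    %≢0 {p} p≤m %≡0 = between-multiples⇒%≢0 {q = q} (<-≤-trans low (end≤run p≤m)) (≤-<-trans (run≤start p≤m) high)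
                        (trans (%-remove-+ʳ ‖ s + p ‖ η∣e) %≡0)

    strict-step : ∀ {p} → p < m → ‖ s + suc p ‖ < ‖ s + p ‖
    strict-step {p} p<m = subst (λ x → ‖ x ‖ < ‖ s + p ‖) (sym (+-suc s p))
      (≺-over⇒size< {μ ! suc (s + p)} {μ ! (s + p)} over-next
        (over-suc⇒!-suc-≺ (1≤position p) next≤len over-next))
      where
      next≤len : suc (s + p) ≤ length μ
      next≤len = subst (_≤ length μ) (+-suc s p) (position≤len p<m)
      over-next : over (μ ! suc (s + p)) ≡ true
      over-next = %≢0⇒over (s≤s z≤n) next≤len (subst (λ x → ‖ x ‖ % η ≢ 0) (+-suc s p) (%≢0 p<m))

    residue : ∀ p → p ≤ m → AlphaResidue (run s e p)
    residue p p≤m with residues (s + p) (1≤position p) (position≤len p≤m)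
    ... | inj₁ %≡0 = contradiction %≡0 (%≢0 p≤m)
    ... | inj₂ (τ , 1≤τ , τ≤lam , %≡ατ) = τ , 1≤τ , τ≤lam , trans (%-remove-+ʳ ‖ s + p ‖ η∣e) %≡ατ

  plain-run-chain : ∀ {s s'} q {w} → 1 ≤ s → s ≤ s' → s' ≤ length μ →
                    q * η < ‖ s' ‖ → ‖ s ‖ < suc q * η → ‖ s ‖ ≤ w → w < ‖ s' ‖ + η →
                    ResidueChain w (run s 0) (s' ∸ s)
  plain-run-chain {s} {s'} q 1≤s s≤s' s'≤len low high start≤w w<end =
    run-chain q (η ∣0) 1≤s s≤s' s'≤len
      (<-≤-trans low (≤-reflexive (sym (+-identityʳ ‖ s' ‖))))
      (≤-<-trans (≤-reflexive (+-identityʳ ‖ s ‖)) high)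
      (≤-trans (≤-reflexive (+-identityʳ ‖ s ‖)) start≤w)
      (<-≤-trans w<end (≤-reflexive (cong (_+ η) (sym (+-identityʳ ‖ s' ‖)))))

  module KSetPair (r : ℕ) {i j : ℕ} (lam≤1+n : lam ≤ suc n)
    (1≤i : 1 ≤ i) (i-end : i + suc (suc n) ∸ 2 ≤ length μ)
    (i-block : ≼-strictIf (over (μ ! i)) (μ ! i) ((μ ! (i + suc (suc n) ∸ 2)) ⊕ η))
    (1≤j : 1 ≤ j) (j-end : j + suc (suc n) ∸ 2 ≤ length μ)
    (j-block : ≼-strictIf (over (μ ! j)) (μ ! j) ((μ ! (j + suc (suc n) ∸ 2)) ⊕ η))
    (μi≺μj : (μ ! i) ≺ (μ ! j))
    (close : ≼-strictIf (over (μ ! j)) ((μ ! j) ⊖ (2 * η)) (μ ! (i + suc (suc n) ∸ 2)))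
    where

    last≡ : ∀ s → s + suc (suc n) ∸ 2 ≡ s + n
    last≡ s = +-∸-assoc s (s≤s (s≤s z≤n))

    i+n≤len : i + n ≤ length μ
    i+n≤len = subst (_≤ length μ) (last≡ i) i-end

    j+n≤len : j + n ≤ length μ
    j+n≤len = subst (_≤ length μ) (last≡ j) j-end

    i≤len : i ≤ length μ
    i≤len = ≤-trans (m≤m+n i n) i+n≤len

    j≤len : j ≤ length μ
    j≤len = ≤-trans (m≤m+n j n) j+n≤len

    j<i : j < i
    j<i = ≰⇒> λ i≤j → <⇒≱ μi≺μj (!-antitone 1≤i i≤j j≤len)

    block-size : ∀ {s} → ≼-strictIf (over (μ ! s)) (μ ! s) ((μ ! (s + suc (suc n) ∸ 2)) ⊕ η) → ‖ s ‖ ≤ ‖ s + n ‖ + η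
    block-size {s} block = subst (λ e → ‖ s ‖ ≤ ‖ e ‖ + η) (last≡ s) (≼-strictIf⇒size≤ {μ ! s} block)

    block-size-over : ∀ {s} → ≼-strictIf (over (μ ! s)) (μ ! s) ((μ ! (s + suc (suc n) ∸ 2)) ⊕ η) →
                      over (μ ! s) ≡ true → ‖ s ‖ < ‖ s + n ‖ + η
    block-size-over {s} block over-s =
      subst (λ e → ‖ s ‖ < ‖ e ‖ + η) (last≡ s) (≼-strictIf-over⇒size< {μ ! s} over-s block)

    close-size : ‖ j ‖ ≤ ‖ i + n ‖ + 2 * η
    close-size = ∸≤⇒≤+ ‖ j ‖ (2 * η)
      (subst (λ e → ‖ j ‖ ∸ 2 * η ≤ ‖ e ‖) (last≡ i) (≼-strictIf⇒size≤ {(μ ! j) ⊖ (2 * η)} close))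

    close-size-over : over (μ ! j) ≡ true → ‖ j ‖ < ‖ i + n ‖ + 2 * η
    close-size-over over-j = ∸<⇒<+ ‖ j ‖ (2 * η)
      (subst (λ e → ‖ j ‖ ∸ 2 * η < ‖ e ‖) (last≡ i) (≼-strictIf-over⇒size< {(μ ! j) ⊖ (2 * η)} over-j close))

    module Step {t : ℕ} (j≤t : j ≤ t) (t<i : t < i) where

      1≤t : 1 ≤ t
      1≤t = ≤-trans 1≤j j≤t

      t≤len : t ≤ length μ
      t≤len = ≤-trans (<⇒≤ t<i) i≤len

      1≤t+1+n : 1 ≤ t + suc n
      1≤t+1+n = ≤-trans 1≤t (m≤m+n t (suc n))

      t+1+n≤i+n : t + suc n ≤ i + n
      t+1+n≤i+n = subst (_≤ i + n) (sym (+-suc t n)) (+-monoˡ-≤ n t<i)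

      t+1+n≤len : t + suc n ≤ length μ
      t+1+n≤len = ≤-trans t+1+n≤i+n i+n≤len

      ‖t‖≤‖j‖ : ‖ t ‖ ≤ ‖ j ‖
      ‖t‖≤‖j‖ = ≼⇒size≤ {μ ! t} {μ ! j} (!-antitone 1≤j j≤t t≤len)

      ‖i+n‖≤‖t+1+n‖ : ‖ i + n ‖ ≤ ‖ t + suc n ‖
      ‖i+n‖≤‖t+1+n‖ = ≼⇒size≤ {μ ! (i + n)} {μ ! (t + suc n)} (!-antitone 1≤t+1+n t+1+n≤i+n i+n≤len)

      ‖j‖≤‖t+1+n‖+2η : ‖ j ‖ ≤ ‖ t + suc n ‖ + 2 * η
      ‖j‖≤‖t+1+n‖+2η = ≤-trans close-size (+-monoˡ-≤ (2 * η) ‖i+n‖≤‖t+1+n‖)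

      -- If [μ_{t+k-1}/η] < [μ_t/η] − 1, then μ_j, …, μ_t, then μ_{t+k-1} + η, …, μ_{i+k-2} + η,
      -- then μ_i, …, μ_{j+k-2} are at least k strictly decreasing values in (μ_j − η, μ_j], none
      -- divisible by η, hence with at least k distinct residues among α_1, …, α_λ.
      module Collapse {a : ℕ} (over-t : over (μ ! t) ≡ true) (t/η≡1+a : ‖ t ‖ / η ≡ suc a)
                      (collapse : ‖ t + suc n ‖ < a * η) where

        [1+a]η<‖t‖ : suc a * η < ‖ t ‖
        [1+a]η<‖t‖ = subst (λ q → q * η < ‖ t ‖) t/η≡1+a (%≢0⇒/-*< ‖ t ‖ (over⇒%≢0 1≤t t≤len over-t))

        [1+a]η<‖j‖ : suc a * η < ‖ j ‖
        [1+a]η<‖j‖ = <-≤-trans [1+a]η<‖t‖ ‖t‖≤‖j‖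

        ‖t+1+n‖+η<[1+a]η : ‖ t + suc n ‖ + η < suc a * η
        ‖t+1+n‖+η<[1+a]η = subst (‖ t + suc n ‖ + η <_) (+-comm (a * η) η) (+-monoˡ-< η collapse)

        ‖i+n‖+η<[1+a]η : ‖ i + n ‖ + η < suc a * η
        ‖i+n‖+η<[1+a]η = ≤-<-trans (+-monoˡ-≤ η ‖i+n‖≤‖t+1+n‖) ‖t+1+n‖+η<[1+a]η

        ‖j‖<[2+a]η : ‖ j ‖ < suc (suc a) * η
        ‖j‖<[2+a]η = begin-strict
          ‖ j ‖                   ≤⟨ ‖j‖≤‖t+1+n‖+2η ⟩
          ‖ t + suc n ‖ + 2 * η   <⟨ +-monoˡ-< (2 * η) collapse ⟩
          a * η + 2 * η           ≡⟨ regroup a η ⟩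
          suc (suc a) * η         ∎
          where
          open ≤-Reasoning
          regroup : ∀ a η → a * η + 2 * η ≡ suc (suc a) * η
          regroup = solve-∀

        over-j : over (μ ! j) ≡ true
        over-j = %≢0⇒over 1≤j j≤len (between-multiples⇒%≢0 {q = suc a} [1+a]η<‖j‖ ‖j‖<[2+a]η)

        ‖j‖<‖i+n‖+η+η : ‖ j ‖ < ‖ i + n ‖ + η + η
        ‖j‖<‖i+n‖+η+η = <-≤-trans (close-size-over over-j) (≤-reflexive (regroup ‖ i + n ‖ η))
          where
          regroup : ∀ x η → x + 2 * η ≡ x + η + η
          regroup = solve-∀

        ‖j‖<‖j+n‖+η : ‖ j ‖ < ‖ j + n ‖ + η
        ‖j‖<‖j+n‖+η = block-size-over j-block over-j

        aη<‖i+n‖+η : a * η < ‖ i + n ‖ + η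
        aη<‖i+n‖+η = +-cancelʳ-< η (a * η) (‖ i + n ‖ + η)
          (subst (_< ‖ i + n ‖ + η + η) (+-comm η (a * η)) (<-trans [1+a]η<‖j‖ ‖j‖<‖i+n‖+η+η))

        aη<‖j+n‖ : a * η < ‖ j + n ‖
        aη<‖j+n‖ = +-cancelʳ-< η (a * η) ‖ j + n ‖
          (subst (_< ‖ j + n ‖ + η) (+-comm η (a * η)) (<-trans [1+a]η<‖j‖ ‖j‖<‖j+n‖+η))

        t≤j+n : t ≤ j + n
        t≤j+n = ≮⇒≥ λ j+n<t → <-asym [1+a]η<‖t‖ (‖t‖<[1+a]η (subst (_≤ t) (sym (+-suc j n)) j+n<t))
          where
          ‖t‖<[1+a]η : j + suc n ≤ t → ‖ t ‖ < suc a * η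
          ‖t‖<[1+a]η j+1+n≤t = +-cancelʳ-< η ‖ t ‖ (suc a * η) (begin-strict
            ‖ t ‖ + η              ≤⟨ +-monoˡ-≤ η (≼⇒size≤ {μ ! t} {μ ! (j + suc n)}
                                        (!-antitone (≤-trans 1≤j (m≤m+n j (suc n))) j+1+n≤t t≤len)) ⟩
            ‖ j + suc n ‖ + η      ≤⟨ gap-size 1≤j (≤-trans j+1+n≤t t≤len) ⟩
            ‖ j ‖                  <⟨ ‖j‖<‖i+n‖+η+η ⟩
            ‖ i + n ‖ + η + η      <⟨ +-monoˡ-< η ‖i+n‖+η<[1+a]η ⟩
            suc a * η + η          ∎)
            where open ≤-Reasoning

        ‖i‖<‖i+n‖+η : ‖ i ‖ < ‖ i + n ‖ + η
        ‖i‖<‖i+n‖+η = ≤∧≢⇒< (block-size i-block) λ ‖i‖≡ → <-irrefl ‖i‖≡ (block-size-over i-block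
          (%≢0⇒over 1≤i i≤len (subst (λ x → x % η ≢ 0) (sym ‖i‖≡)
            (between-multiples⇒%≢0 {q = a} aη<‖i+n‖+η ‖i+n‖+η<[1+a]η))))

        first-run : ResidueChain ‖ j ‖ (run j 0) (t ∸ j)
        first-run = plain-run-chain (suc a) 1≤j j≤t t≤len [1+a]η<‖t‖ ‖j‖<[2+a]η ≤-refl
          (<-≤-trans ‖j‖<‖j+n‖+η (+-monoˡ-≤ η (≼⇒size≤ {μ ! (j + n)} {μ ! t}
            (!-antitone 1≤t t≤j+n j+n≤len))))

        second-run : ResidueChain ‖ j ‖ (run (t + suc n) η) (i + n ∸ (t + suc n))
        second-run = run-chain a ∣-refl 1≤t+1+n t+1+n≤i+n i+n≤len aη<‖i+n‖+η ‖t+1+n‖+η<[1+a]η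
          (<⇒≤ (<-trans ‖t+1+n‖+η<[1+a]η [1+a]η<‖j‖)) ‖j‖<‖i+n‖+η+η

        third-run : i ≤ j + n → ResidueChain ‖ j ‖ (run i 0) (j + n ∸ i)
        third-run i≤j+n = plain-run-chain a 1≤i i≤j+n j+n≤len aη<‖j+n‖
          (<-trans ‖i‖<‖i+n‖+η ‖i+n‖+η<[1+a]η)
          (≼⇒size≤ {μ ! i} {μ ! j} (!-antitone 1≤j (<⇒≤ j<i) i≤len)) ‖j‖<‖j+n‖+η

        first→second : run (t + suc n) η 0 < run j 0 (t ∸ j)
        first→second = subst₂ _<_ (sym (run-start (t + suc n) η)) (sym (run-end 0 j≤t))
          (<-≤-trans (<-trans ‖t+1+n‖+η<[1+a]η [1+a]η<‖t‖) (m≤m+n ‖ t ‖ 0))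

        second→third : run i 0 0 < run (t + suc n) η (i + n ∸ (t + suc n))
        second→third = subst₂ _<_ (sym (run-start i 0)) (sym (run-end η t+1+n≤i+n))
          (≤-<-trans (≤-reflexive (+-identityʳ ‖ i ‖)) ‖i‖<‖i+n‖+η)

        absurd : ⊥
        absurd with i ≤? j + n
        ... | yes i≤j+n = <⇒≱
          (chain-length (glue-chain first-run (glue-chain second-run (third-run i≤j+n) second→third) first→second))
          (≤-trans lam≤1+n (≤-reflexive (cong suc (sym (three-runs-length j≤t t+1+n≤i+n i≤j+n)))))
        ... | no  i≰j+n = <⇒≱
          (chain-length (glue-chain first-run second-run first→second))
          (≤-trans lam≤1+n (s≤s (two-runs-length j≤t t+1+n≤i+n (≰⇒> i≰j+n))))

      floor-step : ‖ t ‖ / η + bit (over (μ ! t)) ≡ ‖ t + suc n ‖ / η + 2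
      floor-step with over (μ ! t) in over-t
      ... | false = trans (+-identityʳ _) (/-two-below-multiple (plain⇒%≡0 1≤t t≤len over-t)
                      (gap-size-plain 1≤t t+1+n≤len over-t) (≤-trans ‖t‖≤‖j‖ ‖j‖≤‖t+1+n‖+2η))
      ... | true  = /-one-below-gap (gap-size 1≤t t+1+n≤len) no-collapse
        where
        no-collapse : (‖ t ‖ / η ∸ 1) * η ≤ ‖ t + suc n ‖
        no-collapse with ‖ t ‖ / η in t/η
        ... | zero  = z≤n
        ... | suc a = ≮⇒≥ (Collapse.absurd over-t t/η)

    Q : ℕ → ℕ
    Q s = floorSum lam α η (suc (suc n)) r μ s + Vbar μ (μ ! s)

    Q-step : ∀ l → l < i ∸ j → Q (j + l) ≡ Q (suc (j + l)) + 2
    Q-step l l<i∸j = window-invariant-step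
      {S' = floorSum lam α η (suc (suc n)) r μ (suc (j + l))} {V' = Vbar μ (μ ! suc (j + l))}
      {F = ‖ j + l ‖ / η} {b = bit (over (μ ! (j + l)))}
      (sum-window-slide (λ x → ‖ x ‖ / η) (j + l) (suc n))
      floor-step
      (Vbar-suc 1≤t (≤-trans t<i i≤len))
      where
      t<i : j + l < i
      t<i = subst (j + l <_) (m+[n∸m]≡n (<⇒≤ j<i)) (+-monoʳ-< j l<i∸j)
      open Step (m≤m+n j l) t<i

    Q-telescope : Q j ≡ Q i + (i ∸ j) * 2
    Q-telescope = subst (λ x → Q j ≡ Q x + (i ∸ j) * 2) (m+[n∸m]≡n (<⇒≤ j<i)) (telescope Q 2 j (i ∸ j) Q-step)

    same-parity : (Q j + 1) % 2 ≡ (Q i + 1) % 2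
    same-parity = begin
      (Q j + 1) % 2                 ≡⟨ cong (λ x → (x + 1) % 2) Q-telescope ⟩
      (Q i + (i ∸ j) * 2 + 1) % 2   ≡⟨ cong (_% 2) (regroup (Q i) (i ∸ j)) ⟩
      (Q i + 1 + (i ∸ j) * 2) % 2   ≡⟨ [m+kn]%n≡m%n (Q i + 1) (i ∸ j) 2 ⟩
      (Q i + 1) % 2                 ∎
      where
      open ≡-Reasoning
      regroup : ∀ q h → q + h * 2 + 1 ≡ q + 1 + h * 2
      regroup = solve-∀

    even-type⇔ : ∀ s → EvenType lam α η (suc (suc n)) r μ s ⇔ ((Q s + 1) % 2 ≡ r % 2)
    even-type⇔ s = %2-move-+ (floorSum lam α η (suc (suc n)) r μ s) (Vbar μ (μ ! s)) r

    same-type : SameType lam α η (suc (suc n)) r μ i j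
    same-type = same-truth-value ((Q i + 1) % 2 ≟ r % 2) (even-type⇔ i)
      (subst (λ x → EvenType lam α η (suc (suc n)) r μ j ⇔ (x ≡ r % 2)) same-parity (even-type⇔ j))

k≡1⇒no-parts : ∀ {lam α η} .{{_ : NonZero η}} {r} μ → InB1 lam α η 1 r μ →
               ∀ {s} → 1 ≤ s → s ≤ length μ → ⊥
k≡1⇒no-parts {η = η} μ (_ , _ , _ , gap , _) {s} 1≤s s≤len =
  <⇒≱ (m<m+n (size (μ ! s)) (>-nonZero⁻¹ η)) (subst (λ e → size (μ ! e) + η ≤ size (μ ! s)) s+1∸1≡s
    (≼⇒size≤ {(μ ! (s + 1 ∸ 1)) ⊕ η} {μ ! s} (≼-strictIf⇒≼ _ (gap s 1≤s (subst (_≤ length μ) (sym s+1∸1≡s) s≤len)))))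
  where
  s+1∸1≡s : s + 1 ∸ 1 ≡ s
  s+1∸1≡s = m+n∸n≡m s 1

lemma3p3 : (lam : ℕ) (α : ℕ → ℕ) (η : ℕ) .{{_ : NonZero η}} (k r : ℕ) →
    (∀ t → 1 ≤ t → t ≤ lam → 0 < α t × α t < η) →
    (∀ t → 1 ≤ t → t < lam → α t < α (t + 1)) →
    (∀ t → 1 ≤ t → t ≤ lam → α t ≡ η ∸ α (lam + 1 ∸ t)) →
    r ≤ k → lam ≤ r → lam < k →
    (μ : List Part) → InB1 lam α η k r μ →
    (i j : ℕ) → IsKSet lam α η k r μ i → IsKSet lam α η k r μ j →
    (μ ! i) ≺ (μ ! j) →
    ≼-strictIf (over (μ ! j)) ((μ ! j) ⊖ (2 * η)) (μ ! (i + k ∸ 2)) →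
    SameType lam α η k r μ i j
lemma3p3 lam α η zero r _ _ _ _ _ () μ B i j Ki Kj μi≺μj close
lemma3p3 lam α η (suc zero) r _ _ _ _ _ _ μ B i j (1≤i , i≤len , _) Kj μi≺μj close =
  ⊥-elim (k≡1⇒no-parts μ B 1≤i i≤len)
lemma3p3 lam α η (suc (suc n)) r _ _ _ _ _ lam<k μ (isOP , residues , overlined , gap , _) i j
         (1≤i , _ , i-end , _ , i-block) (1≤j , _ , j-end , _ , j-block) μi≺μj close =
  Element.KSetPair.same-type lam α η n μ isOP residues overlined gap r (≤-pred lam<k)
    1≤i i-end i-block 1≤j j-end j-block μi≺μj close
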